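{- Let $2\le k\le n-2$ and let $I,J$ be nonfrozen $k$-subsets of $[n]$ forming a noncrossing pair. Then for each $j\in\{1,\ldots,n-k-1\}$, $\gamma_I$ and $\gamma_J$ can be simultaneously minimized on $\mathrm{Newt}(Q_j)$: there is a point $\alpha_0\in\mathrm{Newt}(Q_j)$ with $\gamma_I(\alpha)\ge\gamma_I(\alpha_0)$ and $\gamma_J(\alpha)\ge\gamma_J(\alpha_0)$ for all $\alpha\in\mathrm{Newt}(Q_j)$.
   Context: A $k$-subset of $[n]$ is frozen if it is a cyclic interval $\{j,\ldots,j+k-1\}$ mod $n$, else nonfrozen. Coordinates $\alpha_{i,j}$, $(i,j)\in[1,k-1]\times[1,n-k]$; $\alpha_{i,[p,q]}=\sum_{t=p}^q\alpha_{i,t}$ (zero if $p>q$); for $S=\{s_1<\cdots<s_k\}$, $\gamma_S(\alpha)=\sum_{i=1}^{k-1}\alpha_{i,[s_i-(i-1),\,s_{i+1}-i-1]}$. $Q_j=\sum x_{1,j+t_1}\cdots x_{k-1,j+t_{k-1}}$ over $(t_i)\in\{0,1\}^{k-1}$ with $t_1\le\cdots\le t_{k-1}$, and $\mathrm{Newt}(Q_j)$ is its Newton polytope in $\mathbb R^{(k-1)\times(n-k)}$ ($x_{i,j}\leftrightarrow e_{i,j}$). $r$-subsets $A,B$ are weakly separated if there are no $a,b,c,d$ in this cyclic order in $(1,\ldots,n)$ with $a,c\in A\setminus B$, $b,d\in B\setminus A$; $k$-subsets $A=\{a_1<\cdots<a_k\}$, $B=\{b_1<\cdots<b_k\}$ are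 noncrossing if for each $1\le p<q\le k$ either $\{a_p..a_q\}$, $\{b_p..b_q\}$ are weakly separated or $\{a_{p+1},..,a_{q-1}\}\ne\{b_{p+1},..,b_{q-1}\}$.
   Formalization: The Newton polytope $\mathrm{Newt}(Q_j)$ is taken over ℚ instead of $\mathbb R^{(k-1)\times(n-k)}$, so the points α and α₀ have rational coordinates. -}

module Defs where

open import Data.Nat as ℕ using (ℕ; zero; suc; _∸_; _%_; _≤?_; _≟_)
open import Data.Bool using (Bool; true; false; if_then_else_; _∧_)
open import Data.List using (List; []; _∷_; length; map; foldr; upTo; take; drop)
open import Data.List.Membership.Propositional using (_∈_; _∉_)
open import Data.List.Relation.Unary.All using (All)
open import Data.List.Relation.Unary.Linked using (Linked)
open import Data.Product using (Σ; ∃; _×_; _,_)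
open import Data.Sum using (_⊎_)
open import Data.Rational as ℚ using (ℚ; 0ℚ; 1ℚ)
open import Relation.Binary.PropositionalEquality using (_≡_)
open import Relation.Nullary using (¬_; ⌊_⌋)
open import Function.Bundles using (_⇔_)

record IsKSubset (n k : ℕ) (S : List ℕ) : Set where
  field
    size     : length S ≡ k
    sorted   : Linked ℕ._<_ S
    inRange  : All (λ x → 1 ℕ.≤ x × x ℕ.≤ n) S

-- element at 0-based position p (default 0); s_i (1-based) = at S (i ∸ 1)
at : List ℕ → ℕ → ℕ
at []       _       = 0
at (x ∷ _)  zero    = x
at (_ ∷ xs) (suc p) = at xs p

-- x is the residue of m modulo n in [1,n], for 1 ≤ m < 2n
CycPos : ℕ → ℕ → ℕ → Set
CycPos n m x = (m ℕ.≤ n × x ≡ m) ⊎ (n ℕ.< m × x ℕ.+ n ≡ m)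

Frozen : ℕ → ℕ → List ℕ → Set
Frozen n k S = Σ ℕ λ j → 1 ℕ.≤ j × j ℕ.≤ n ×
  (∀ x → (x ∈ S) ⇔ (Σ ℕ λ t → t ℕ.< k × CycPos n (j ℕ.+ t) x))

CyclicOrder : ℕ → ℕ → ℕ → ℕ → Set
CyclicOrder a b c d =
    (a ℕ.< b × b ℕ.< c × c ℕ.< d)
  ⊎ (b ℕ.< c × c ℕ.< d × d ℕ.< a)
  ⊎ (c ℕ.< d × d ℕ.< a × a ℕ.< b)
  ⊎ (d ℕ.< a × a ℕ.< b × b ℕ.< c)

WeaklySeparated : List ℕ → List ℕ → Set
WeaklySeparated A B = ¬ (Σ ℕ λ a → Σ ℕ λ b → Σ ℕ λ c → Σ ℕ λ d →
  CyclicOrder a b c d ×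
  (a ∈ A × a ∉ B) × (c ∈ A × c ∉ B) ×
  (b ∈ B × b ∉ A) × (d ∈ B × d ∉ A))

SameSet : List ℕ → List ℕ → Set
SameSet A B = ∀ x → (x ∈ A) ⇔ (x ∈ B)

-- {a_p, …, a_q} for 1-based p ≤ q
slice : List ℕ → ℕ → ℕ → List ℕ
slice A p q = take (suc q ∸ p) (drop (p ∸ 1) A)

Noncrossing : ℕ → List ℕ → List ℕ → Set
Noncrossing k A B = ∀ p q → 1 ℕ.≤ p → p ℕ.< q → q ℕ.≤ k →
  WeaklySeparated (slice A p q) (slice B p q)
  ⊎ ¬ SameSet (slice A (suc p) (q ∸ 1)) (slice B (suc p) (q ∸ 1))

-- Points of ℝ^{(k-1)×(n-k)} (rational points): α i t for 1-based
-- indices (i, t) ∈ [1,k-1] × [1,n-k]; coordinates outside are forced 0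
-- by membership in the Newton polytope.

Point : Set
Point = ℕ → ℕ → ℚ

sumℚ : List ℚ → ℚ
sumℚ = foldr ℚ._+_ 0ℚ

-- Σ_{t=p}^{q} f t  (zero if p > q)
sumRange : ℕ → ℕ → (ℕ → ℚ) → ℚ
sumRange p q f = sumℚ (map (λ t → f (p ℕ.+ t)) (upTo (suc q ∸ p)))

γ : ℕ → List ℕ → Point → ℚ
γ k S α = sumRange 1 (k ∸ 1) (λ i →
  sumRange (at S (i ∸ 1) ∸ (i ∸ 1)) (at S i ∸ i ∸ 1) (α i))

-- Newton polytope of Q_j = Σ x_{1,j+t₁} ⋯ x_{k-1,j+t_{k-1}}
-- over (t_i) ∈ {0,1}^{k-1} with t₁ ≤ ⋯ ≤ t_{k-1}.

Admissible : ℕ → (ℕ → ℕ) → Set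
Admissible k t = (∀ i → 1 ℕ.≤ i → i ℕ.≤ k ∸ 1 → t i ℕ.≤ 1)
               × (∀ i i′ → 1 ℕ.≤ i → i ℕ.≤ i′ → i′ ℕ.≤ k ∸ 1 → t i ℕ.≤ t i′)

expVec : ℕ → ℕ → (ℕ → ℕ) → Point
expVec k j t i c =
  if ⌊ 1 ≤? i ⌋ ∧ ⌊ i ≤? k ∸ 1 ⌋ ∧ ⌊ c ≟ j ℕ.+ t i ⌋ then 1ℚ else 0ℚ

InSupport : ℕ → ℕ → Point → Set
InSupport k j β = Σ (ℕ → ℕ) λ t → Admissible k t × (∀ i c → β i c ≡ expVec k j t i c)

InConvexHull : (Point → Set) → Point → Set
InConvexHull P α = Σ (List (ℚ × Point)) λ ws →
    All (λ w → let (λw , β) = w in 0ℚ ℚ.≤ λw × P β) ws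
  × sumℚ (map (λ w → let (λw , _) = w in λw) ws) ≡ 1ℚ
  × (∀ i c → α i c ≡ sumℚ (map (λ w → let (λw , β) = w in λw ℚ.* β i c) ws))

Newt : ℕ → ℕ → Point → Set
Newt k j = InConvexHull (InSupport k j)

-- γ_S is linear and Newt(Q_j) is the convex hull of the exponent vectors of Q_j, so it suffices to
-- find one monotone 0/1 choice t minimising both γ_I and γ_J over all such choices. At the vertex of t,
-- γ_S counts the rows i whose column j + t_i lies in [s_i - i + 1, s_{i+1} - i); these intervals tile
-- the window [s_1, s_k - k + 1). So the minimum is 1 if j and j + 1 both lie in the window and 0
-- otherwise, and the constant choice t ≡ 1 (resp. t ≡ 0) attains it unless the window begins (resp.
-- ends) right at j + 1. When the window of one subset begins and that of the other ends there, a
-- threshold choice (0 on the rows up to q, 1 after) misses every row of both: otherwise the entries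
-- of I and J around those rows form slices with equal interiors that are not weakly separated.

module Submission where

open import Defs
open import Data.Nat using (ℕ; _≤_; _+_; _∸_)
open import Data.List using (List)
open import Data.Product using (Σ; _×_)
open import Relation.Nullary using (¬_)
import Data.Rational as ℚ

open import Algebra.Bundles using (CommutativeMonoid)
import Algebra.Properties.CommutativeSemigroup as CommutativeSemigroupProperties
open import Data.Bool using (true; false; if_then_else_; _∧_)
open import Data.Bool.Properties using (∧-zeroʳ)
open import Data.Empty using (⊥-elim)
open import Data.List using ([]; _∷_; length; map; upTo; applyUpTo; take)
open import Data.List.Membership.Propositional using (_∈_; _∉_)
open import Data.List.Properties using (map-cong)
open import Data.List.Relation.Unary.All using (All; []; _∷_)
open import Data.List.Relation.Unary.Any using (here; there)
open import Data.List.Relation.Unary.Linked using (Linked; [-]; _∷_)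
open import Data.Nat using (zero; suc; _<_; _≤?_; _<?_; _≟_; z≤n; s≤s)
open import Data.Nat.Properties
open import Data.Product using (_,_; proj₁; proj₂)
open import Data.Rational using (ℚ; 0ℚ; 1ℚ)
import Data.Rational.Properties as ℚP
open import Data.Sum using (_⊎_; inj₁; inj₂)
open import Function.Bundles using (Equivalence; mk⇔)
open import Relation.Binary.PropositionalEquality
open import Relation.Nullary using (Dec; yes; no; ⌊_⌋)
open import Relation.Nullary.Decidable using (_×-dec_; dec-true; dec-false; isYes≗does)

fromℕ : ℕ → ℚ
fromℕ zero    = 0ℚ
fromℕ (suc n) = 1ℚ ℚ.+ fromℕ n

fromℕ-+ : ∀ m n → fromℕ (m + n) ≡ fromℕ m ℚ.+ fromℕ n
fromℕ-+ zero    n = sym (ℚP.+-identityˡ (fromℕ n))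
fromℕ-+ (suc m) n = trans (cong (1ℚ ℚ.+_) (fromℕ-+ m n)) (sym (ℚP.+-assoc 1ℚ (fromℕ m) (fromℕ n)))

fromℕ-mono-≤ : ∀ {m n} → m ≤ n → fromℕ m ℚ.≤ fromℕ n
fromℕ-mono-≤ {n = zero}  z≤n     = ℚP.≤-refl
fromℕ-mono-≤ {n = suc n} z≤n     = ℚP.+-mono-≤ (ℚP.nonNegative⁻¹ 1ℚ) (fromℕ-mono-≤ {n = n} z≤n)
fromℕ-mono-≤             (s≤s p) = ℚP.+-monoʳ-≤ 1ℚ (fromℕ-mono-≤ p)

fromℕ-if : ∀ b → (if b then 1ℚ else 0ℚ) ≡ fromℕ (if b then 1 else 0)
fromℕ-if true  = sym (ℚP.+-identityʳ 1ℚ)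
fromℕ-if false = refl

sumBelow : (ℕ → ℕ) → ℕ → ℕ
sumBelow f zero    = 0
sumBelow f (suc n) = f 0 + sumBelow (λ r → f (suc r)) n

sumBelow-cong : ∀ {f g} n → (∀ r → r < n → f r ≡ g r) → sumBelow f n ≡ sumBelow g n
sumBelow-cong zero    f≡g = refl
sumBelow-cong (suc n) f≡g = cong₂ _+_ (f≡g 0 (s≤s z≤n)) (sumBelow-cong n (λ r r<n → f≡g (suc r) (s≤s r<n)))

sumBelow-≡0 : ∀ {f} n → (∀ r → r < n → f r ≡ 0) → sumBelow f n ≡ 0
sumBelow-≡0 zero    f≡0 = refl
sumBelow-≡0 (suc n) f≡0 = cong₂ _+_ (f≡0 0 (s≤s z≤n)) (sumBelow-≡0 n (λ r r<n → f≡0 (suc r) (s≤s r<n)))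

sumBelow-≥-term : ∀ {f} n r → r < n → f r ≤ sumBelow f n
sumBelow-≥-term {f} (suc n) zero    _         = m≤m+n (f 0) _
sumBelow-≥-term {f} (suc n) (suc r) (s≤s r<n) = ≤-trans (sumBelow-≥-term n r r<n) (m≤n+m _ (f 0))

sumBelow-shift : ∀ f p n → sumBelow (λ t → f (p + t)) (suc n) ≡ f p + sumBelow (λ t → f (suc p + t)) n
sumBelow-shift f p n =
  cong₂ _+_ (cong f (+-identityʳ p)) (sumBelow-cong n (λ r _ → cong f (+-suc p r)))

sumℚ-fromℕ : ∀ (f h : ℕ → ℕ) n →
  sumℚ (map (λ t → fromℕ (f t)) (applyUpTo h n)) ≡ fromℕ (sumBelow (λ t → f (h t)) n)
sumℚ-fromℕ f h zero    = refl
sumℚ-fromℕ f h (suc n) =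
  trans (cong (fromℕ (f (h 0)) ℚ.+_) (sumℚ-fromℕ f (λ t → h (suc t)) n)) (sym (fromℕ-+ (f (h 0)) _))

module _ {A : Set} where

  sumℚ-map-0 : ∀ (xs : List A) → sumℚ (map (λ _ → 0ℚ) xs) ≡ 0ℚ
  sumℚ-map-0 []       = refl
  sumℚ-map-0 (x ∷ xs) = trans (cong (0ℚ ℚ.+_) (sumℚ-map-0 xs)) (ℚP.+-identityˡ 0ℚ)

  sumℚ-map-+ : ∀ (f g : A → ℚ) xs →
    sumℚ (map (λ x → f x ℚ.+ g x) xs) ≡ sumℚ (map f xs) ℚ.+ sumℚ (map g xs)
  sumℚ-map-+ f g []       = sym (ℚP.+-identityˡ 0ℚ)
  sumℚ-map-+ f g (x ∷ xs) =
    trans (cong (f x ℚ.+ g x ℚ.+_) (sumℚ-map-+ f g xs))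
          (interchange (f x) (g x) (sumℚ (map f xs)) (sumℚ (map g xs)))
    where open CommutativeSemigroupProperties
                 (CommutativeMonoid.commutativeSemigroup ℚP.+-0-commutativeMonoid)

  sumℚ-map-*ˡ : ∀ r (f : A → ℚ) xs → sumℚ (map (λ x → r ℚ.* f x) xs) ≡ r ℚ.* sumℚ (map f xs)
  sumℚ-map-*ˡ r f []       = sym (ℚP.*-zeroʳ r)
  sumℚ-map-*ˡ r f (x ∷ xs) =
    trans (cong (r ℚ.* f x ℚ.+_) (sumℚ-map-*ˡ r f xs)) (sym (ℚP.*-distribˡ-+ r (f x) _))

  sumℚ-map-*ʳ : ∀ r (f : A → ℚ) xs → sumℚ (map (λ x → f x ℚ.* r) xs) ≡ sumℚ (map f xs) ℚ.* r
  sumℚ-map-*ʳ r f []       = sym (ℚP.*-zeroˡ r)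
  sumℚ-map-*ʳ r f (x ∷ xs) =
    trans (cong (f x ℚ.* r ℚ.+_) (sumℚ-map-*ʳ r f xs)) (sym (ℚP.*-distribʳ-+ r (f x) _))

  sumℚ-map-mono-≤ : ∀ {P : A → Set} (f g : A → ℚ) {xs} →
    All P xs → (∀ {x} → P x → f x ℚ.≤ g x) → sumℚ (map f xs) ℚ.≤ sumℚ (map g xs)
  sumℚ-map-mono-≤ f g []         f≤g = ℚP.≤-refl
  sumℚ-map-mono-≤ f g (px ∷ pxs) f≤g = ℚP.+-mono-≤ (f≤g px) (sumℚ-map-mono-≤ f g pxs f≤g)

sumRange-cong : ∀ p q {f g : ℕ → ℚ} → (∀ t → f t ≡ g t) → sumRange p q f ≡ sumRange p q g
sumRange-cong p q f≡g = cong sumℚ (map-cong (λ t → f≡g (p + t)) (upTo (suc q ∸ p)))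

sumRange-0 : ∀ p q → sumRange p q (λ _ → 0ℚ) ≡ 0ℚ
sumRange-0 p q = sumℚ-map-0 (upTo (suc q ∸ p))

sumRange-+ : ∀ p q (f g : ℕ → ℚ) →
  sumRange p q (λ t → f t ℚ.+ g t) ≡ sumRange p q f ℚ.+ sumRange p q g
sumRange-+ p q f g = sumℚ-map-+ (λ t → f (p + t)) (λ t → g (p + t)) (upTo (suc q ∸ p))

sumRange-* : ∀ p q r (f : ℕ → ℚ) → sumRange p q (λ t → r ℚ.* f t) ≡ r ℚ.* sumRange p q f
sumRange-* p q r f = sumℚ-map-*ˡ r (λ t → f (p + t)) (upTo (suc q ∸ p))

sumRange-fromℕ : ∀ p q (f : ℕ → ℕ) →
  sumRange p q (λ t → fromℕ (f t)) ≡ fromℕ (sumBelow (λ t → f (p + t)) (suc q ∸ p))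
sumRange-fromℕ p q f = sumℚ-fromℕ (λ t → f (p + t)) (λ t → t) (suc q ∸ p)

combination : List (ℚ × Point) → Point
combination ws i c = sumℚ (map (λ w → proj₁ w ℚ.* proj₂ w i c) ws)

PointwiseEqual : Point → Point → Set
PointwiseEqual α β = ∀ i c → α i c ≡ β i c

record Linear (f : Point → ℚ) : Set where
  field
    cong-pointwise : ∀ {α β} → PointwiseEqual α β → f α ≡ f β
    combination-homo : ∀ ws → f (combination ws) ≡ sumℚ (map (λ w → proj₁ w ℚ.* f (proj₂ w)) ws)

convexHull-lowerBound : ∀ {f} → Linear f → ∀ {P} M → (∀ β → P β → M ℚ.≤ f β) →
  ∀ α → InConvexHull P α → M ℚ.≤ f α
convexHull-lowerBound {f} lin {P} M M≤f α (ws , nonneg , weights≡1 , α≡) = begin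
  M                                              ≡⟨ sym (ℚP.*-identityˡ M) ⟩
  1ℚ ℚ.* M                                       ≡⟨ cong (ℚ._* M) (sym weights≡1) ⟩
  sumℚ (map proj₁ ws) ℚ.* M                      ≡⟨ sym (sumℚ-map-*ʳ M proj₁ ws) ⟩
  sumℚ (map (λ w → proj₁ w ℚ.* M) ws)            ≤⟨ sumℚ-map-mono-≤ _ _ nonneg weighted ⟩
  sumℚ (map (λ w → proj₁ w ℚ.* f (proj₂ w)) ws)  ≡⟨ sym (combination-homo ws) ⟩
  f (combination ws)                             ≡⟨ sym (cong-pointwise α≡) ⟩
  f α                                            ∎
  where
  open Linear lin
  open ℚP.≤-Reasoning
  weighted : ∀ {w} → 0ℚ ℚ.≤ proj₁ w × P (proj₂ w) → proj₁ w ℚ.* M ℚ.≤ proj₁ w ℚ.* f (proj₂ w)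
  weighted {r , β} (0≤r , Pβ) = ℚP.*-monoˡ-≤-nonNeg r {{ℚ.nonNegative 0≤r}} (M≤f β Pβ)

γ-linear : ∀ k S → Linear (γ k S)
γ-linear k S = record { cong-pointwise = γ-cong ; combination-homo = γ-combination }
  where
  lo hi : ℕ → ℕ
  lo i = at S (i ∸ 1) ∸ (i ∸ 1)
  hi i = at S i ∸ i ∸ 1

  row : Point → ℕ → ℚ
  row α i = sumRange (lo i) (hi i) (α i)

  onRows : ∀ {F G : ℕ → ℚ} → (∀ i → F i ≡ G i) → sumRange 1 (k ∸ 1) F ≡ sumRange 1 (k ∸ 1) G
  onRows = sumRange-cong 1 (k ∸ 1)

  γ-cong : ∀ {α β} → PointwiseEqual α β → γ k S α ≡ γ k S β
  γ-cong α≡β = onRows (λ i → sumRange-cong (lo i) (hi i) (α≡β i))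

  γ-0 : γ k S (λ _ _ → 0ℚ) ≡ 0ℚ
  γ-0 = trans (onRows (λ i → sumRange-0 (lo i) (hi i))) (sumRange-0 1 (k ∸ 1))

  γ-+ : ∀ α β → γ k S (λ i c → α i c ℚ.+ β i c) ≡ γ k S α ℚ.+ γ k S β
  γ-+ α β = trans (onRows (λ i → sumRange-+ (lo i) (hi i) (α i) (β i)))
                  (sumRange-+ 1 (k ∸ 1) (row α) (row β))

  γ-* : ∀ r α → γ k S (λ i c → r ℚ.* α i c) ≡ r ℚ.* γ k S α
  γ-* r α = trans (onRows (λ i → sumRange-* (lo i) (hi i) r (α i))) (sumRange-* 1 (k ∸ 1) r (row α))

  γ-combination : ∀ ws → γ k S (combination ws) ≡ sumℚ (map (λ w → proj₁ w ℚ.* γ k S (proj₂ w)) ws)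
  γ-combination []             = γ-0
  γ-combination ((r , β) ∷ ws) =
    trans (γ-+ (λ i c → r ℚ.* β i c) (combination ws)) (cong₂ ℚ._+_ (γ-* r β) (γ-combination ws))

expVec∈Newt : ∀ k j t → Admissible k t → Newt k j (expVec k j t)
expVec∈Newt k j t adm =
  (1ℚ , expVec k j t) ∷ [] ,
  (ℚP.nonNegative⁻¹ 1ℚ , t , adm , λ _ _ → refl) ∷ [] ,
  ℚP.+-identityʳ 1ℚ ,
  λ i c → sym (trans (ℚP.+-identityʳ _) (ℚP.*-identityˡ _))

γ-minimal-on-Newt : ∀ k j S t →
  (∀ t′ → Admissible k t′ → γ k S (expVec k j t) ℚ.≤ γ k S (expVec k j t′)) →
  ∀ α → Newt k j α → γ k S (expVec k j t) ℚ.≤ γ k S α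
γ-minimal-on-Newt k j S t minimal = convexHull-lowerBound (γ-linear k S) _ onVertices
  where
  onVertices : ∀ β → InSupport k j β → γ k S (expVec k j t) ℚ.≤ γ k S β
  onVertices β (t′ , adm , β≡) =
    subst (_ ℚ.≤_) (sym (Linear.cong-pointwise (γ-linear k S) β≡)) (minimal t′ adm)

⌊⌋-true : ∀ {A : Set} (a? : Dec A) → A → ⌊ a? ⌋ ≡ true
⌊⌋-true a? a = trans (isYes≗does a?) (dec-true a? a)

⌊⌋-false : ∀ {A : Set} (a? : Dec A) → ¬ A → ⌊ a? ⌋ ≡ false
⌊⌋-false a? ¬a = trans (isYes≗does a?) (dec-false a? ¬a)

δ : ℕ → ℕ → ℕ
δ c x = if ⌊ c ≟ x ⌋ then 1 else 0

δ-sum-outside : ∀ p n x → x < p ⊎ p + n ≤ x → sumBelow (λ t → δ (p + t) x) n ≡ 0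
δ-sum-outside p n x outside =
  sumBelow-≡0 n (λ r r<n → cong (if_then 1 else 0) (⌊⌋-false (p + r ≟ x) (missed r<n outside)))
  where
  missed : ∀ {r} → r < n → x < p ⊎ p + n ≤ x → p + r ≢ x
  missed _   (inj₁ x<p)   refl = <⇒≱ x<p (m≤m+n p _)
  missed r<n (inj₂ p+n≤x) refl = <⇒≱ (+-monoʳ-< p r<n) p+n≤x

δ-sum-inside : ∀ p n x → p ≤ x → x < p + n → sumBelow (λ t → δ (p + t) x) n ≡ 1
δ-sum-inside p zero    x p≤x x<p+0 = ⊥-elim (<⇒≱ x<p+0 (subst (_≤ x) (sym (+-identityʳ p)) p≤x))
δ-sum-inside p (suc n) x p≤x x<p+n with m≤n⇒m<n∨m≡n p≤x
... | inj₂ refl = trans (sumBelow-shift (λ c → δ c p) p n)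
                        (cong₂ _+_ (cong (if_then 1 else 0) (⌊⌋-true (p ≟ p) refl))
                                   (δ-sum-outside (suc p) n p (inj₁ (n<1+n p))))
... | inj₁ p<x  = trans (sumBelow-shift (λ c → δ c x) p n)
                        (cong₂ _+_ (cong (if_then 1 else 0) (⌊⌋-false (p ≟ x) (<⇒≢ p<x)))
                                   (δ-sum-inside (suc p) n x p<x (subst (x <_) (+-suc p n) x<p+n)))

inInterval : ℕ → ℕ → ℕ → ℕ
inInterval p q x = if ⌊ p ≤? x ⌋ ∧ ⌊ x <? q ⌋ then 1 else 0

inInterval-inside : ∀ {p q x} → p ≤ x → x < q → inInterval p q x ≡ 1
inInterval-inside {p} {q} {x} p≤x x<q rewrite ⌊⌋-true (p ≤? x) p≤x | ⌊⌋-true (x <? q) x<q = refl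

inInterval-outside : ∀ {p q x} → x < p ⊎ q ≤ x → inInterval p q x ≡ 0
inInterval-outside {p} {q} {x} (inj₁ x<p) rewrite ⌊⌋-false (p ≤? x) (<⇒≱ x<p) = refl
inInterval-outside {p} {q} {x} (inj₂ q≤x)
  rewrite ⌊⌋-false (x <? q) (≤⇒≯ q≤x) | ∧-zeroʳ ⌊ p ≤? x ⌋ = refl

inInterval-≤1 : ∀ p q x → inInterval p q x ≤ 1
inInterval-≤1 p q x with ⌊ p ≤? x ⌋ ∧ ⌊ x <? q ⌋
... | true  = ≤-refl
... | false = z≤n

p+[q∸p]≤x : ∀ {p q x} → p ≤ x → q ≤ x → p + (q ∸ p) ≤ x
p+[q∸p]≤x {p} {q} p≤x q≤x with p ≤? q
... | yes p≤q = subst (_≤ _) (sym (m+[n∸m]≡n p≤q)) q≤x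
... | no  p≰q =
  subst (_≤ _) (sym (trans (cong (p +_) (m≤n⇒m∸n≡0 (<⇒≤ (≰⇒> p≰q)))) (+-identityʳ p))) p≤x

-- The columns summed in a row of γ_S are p ≤ c ≤ q - 1, which is [p, q) only because q ≥ 1.
rowCount : ∀ p q x → 1 ≤ q → sumBelow (λ t → δ (p + t) x) (suc (q ∸ 1) ∸ p) ≡ inInterval p q x
rowCount p (suc q) x _ with x <? p | suc q ≤? x
... | yes x<p | _         = trans (δ-sum-outside p (suc q ∸ p) x (inj₁ x<p)) (sym (inInterval-outside (inj₁ x<p)))
... | no  x≮p | yes q<x   =
  trans (δ-sum-outside p (suc q ∸ p) x (inj₂ (p+[q∸p]≤x (≮⇒≥ x≮p) q<x)))
        (sym (inInterval-outside (inj₂ q<x)))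
... | no  x≮p | no  q≮x   =
  trans (δ-sum-inside p (suc q ∸ p) x (≮⇒≥ x≮p) (subst (x <_) (sym (m+[n∸m]≡n p≤q)) x<q))
        (sym (inInterval-inside (≮⇒≥ x≮p) x<q))
  where
  x<q = ≰⇒> q≮x
  p≤q = ≤-trans (≮⇒≥ x≮p) (<⇒≤ x<q)

Ascending : ℕ → (ℕ → ℕ) → Set
Ascending K b = ∀ r → r < K → b r ≤ b (suc r)

ascending-mono : ∀ {K b} → Ascending K b → ∀ {r r′} → r ≤ r′ → r′ ≤ K → b r ≤ b r′
ascending-mono asc {r} {r′} r≤r′ r′≤K with m≤n⇒m<n∨m≡n r≤r′
... | inj₂ refl = ≤-refl
ascending-mono asc {r} {suc r′} _ r′<K | inj₁ (s≤s r≤r′) =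
  ≤-trans (ascending-mono asc r≤r′ (<⇒≤ r′<K)) (asc r′ r′<K)

rowContaining : ∀ (b : ℕ → ℕ) x N → b 0 ≤ x → x < b N → Σ ℕ λ r → r < N × b r ≤ x × x < b (suc r)
rowContaining b x zero    b₀≤x x<b₀ = ⊥-elim (<⇒≱ x<b₀ b₀≤x)
rowContaining b x (suc N) b₀≤x x<bN with x <? b N
... | yes x<b
  = let (r , r<N , rest) = rowContaining b x N b₀≤x x<b in r , m<n⇒m<1+n r<N , rest
... | no  x≮b = N , n<1+n N , ≮⇒≥ x≮b , x<bN

hits : (ℕ → ℕ) → (ℕ → ℕ) → ℕ → ℕ
hits b c K = sumBelow (λ r → inInterval (b r) (b (suc r)) (c r)) K

Misses : (ℕ → ℕ) → ℕ → ℕ → Set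
Misses b x r = x < b r ⊎ b (suc r) ≤ x

hits-≡0 : ∀ {b c} K → (∀ r → r < K → Misses b (c r) r) → hits b c K ≡ 0
hits-≡0 K misses = sumBelow-≡0 K (λ r r<K → inInterval-outside (misses r r<K))

hits-cong : ∀ {b c c′} K → (∀ r → r < K → c r ≡ c′ r) → hits b c K ≡ hits b c′ K
hits-cong {b} K c≡c′ = sumBelow-cong K (λ r r<K → cong (inInterval (b r) (b (suc r))) (c≡c′ r r<K))

hits-≥1 : ∀ {b c K r x} → r < K → c r ≡ x → b r ≤ x → x < b (suc r) → 1 ≤ hits b c K
hits-≥1 {K = K} {r} r<K refl bᵣ≤x x<bᵣ₊₁ =
  ≤-trans (≤-reflexive (sym (inInterval-inside bᵣ≤x x<bᵣ₊₁))) (sumBelow-≥-term K r r<K)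

misses-outsideWindow : ∀ {K b x} → Ascending K b → x < b 0 ⊎ b K ≤ x → ∀ r → r < K → Misses b x r
misses-outsideWindow asc (inj₁ x<b₀) r r<K = inj₁ (<-≤-trans x<b₀ (ascending-mono asc z≤n (<⇒≤ r<K)))
misses-outsideWindow asc (inj₂ b≤x)  r r<K = inj₂ (≤-trans (ascending-mono asc r<K ≤-refl) b≤x)

-- The intervals [b r, b (r + 1)) are disjoint.
hits-constant-≤1 : ∀ {b} K x → Ascending K b → hits b (λ _ → x) K ≤ 1
hits-constant-≤1         zero    x asc = z≤n
hits-constant-≤1 {b} (suc K) x asc with b 1 ≤? x
... | no  b₁≰x =
  subst (_≤ 1) (sym (trans (cong (inInterval (b 0) (b 1) x +_) laterRows≡0) (+-identityʳ _)))
        (inInterval-≤1 (b 0) (b 1) x)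
  where
  laterRows≡0 : hits (λ r → b (suc r)) (λ _ → x) K ≡ 0
  laterRows≡0 = hits-≡0 K (λ r r<K →
    inj₁ (<-≤-trans (≰⇒> b₁≰x) (ascending-mono asc (s≤s z≤n) (s≤s (<⇒≤ r<K)))))
... | yes b₁≤x = subst (λ h → h + hits (λ r → b (suc r)) (λ _ → x) K ≤ 1)
                       (sym (inInterval-outside (inj₂ b₁≤x)))
                       (hits-constant-≤1 K x (λ r r<K → asc (suc r) (s≤s r<K)))

columns : ℕ → (ℕ → ℕ) → ℕ → ℕ
columns j t r = j + t (suc r)

-- If j and j + 1 both lie in the window [b 0, b K), every admissible choice hits some row:
-- j lies in a row u and j + 1 in a row w ≥ u, and t (u + 1) = 0 or else t (w + 1) = 1.
hits-admissible-≥1 : ∀ {K b j t} → Ascending K b → b 0 ≤ j → suc j < b K → Admissible (suc K) t →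
  1 ≤ hits b (columns j t) K
hits-admissible-≥1 {K} {b} {j} {t} asc b₀≤j j+1<bK (bounded , mono)
  with rowContaining b j K b₀≤j (<-trans (n<1+n j) j+1<bK)
     | rowContaining b (suc j) K (≤-trans b₀≤j (n≤1+n j)) j+1<bK
... | u , u<K , bᵤ≤j , j<bᵤ₊₁ | w , w<K , b_w≤j+1 , j+1<b_w₊₁
  with t (suc u) in tᵤ≡ | bounded (suc u) (s≤s z≤n) u<K
... | zero  | _ = hits-≥1 {b} {columns j t} u<K (trans (cong (j +_) tᵤ≡) (+-identityʳ j)) bᵤ≤j j<bᵤ₊₁
... | suc zero | _ =
  hits-≥1 {b} {columns j t} w<K (trans (cong (j +_) t_w≡1) (+-comm j 1)) b_w≤j+1 j+1<b_w₊₁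
  where
  u≤w : u ≤ w
  u≤w with u ≤? w
  ... | yes u≤w = u≤w
  ... | no  u≰w = ⊥-elim (<⇒≱ (<-trans (n<1+n j) j+1<b_w₊₁)
                                 (≤-trans (ascending-mono asc (≰⇒> u≰w) (<⇒≤ u<K)) bᵤ≤j))
  t_w≡1 : t (suc w) ≡ 1
  t_w≡1 = ≤-antisym (bounded (suc w) (s≤s z≤n) w<K)
                    (subst (_≤ t (suc w)) tᵤ≡ (mono (suc u) (suc w) (s≤s z≤n) (s≤s u≤w) w<K))
... | suc (suc _) | s≤s ()

threshold : ℕ → ℕ → ℕ
threshold q i = if ⌊ i ≤? q ⌋ then 0 else 1

threshold-admissible : ∀ k q → Admissible k (threshold q)
threshold-admissible k q = (λ i _ _ → bounded i) , (λ i i′ _ i≤i′ _ → mono i≤i′)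
  where
  bounded : ∀ i → threshold q i ≤ 1
  bounded i with i ≤? q
  ... | yes _ = z≤n
  ... | no  _ = ≤-refl
  mono : ∀ {i i′} → i ≤ i′ → threshold q i ≤ threshold q i′
  mono {i} {i′} i≤i′ with i ≤? q | i′ ≤? q
  ... | yes _   | _        = z≤n
  ... | no  _   | no  _    = ≤-refl
  ... | no  i≰q | yes i′≤q = ⊥-elim (i≰q (≤-trans i≤i′ i′≤q))

columns-threshold-below : ∀ {j q r} → r < q → columns j (threshold q) r ≡ j
columns-threshold-below {j} {q} {r} r<q with suc r ≤? q
... | yes _   = +-identityʳ j
... | no  r≮q = ⊥-elim (r≮q r<q)

columns-threshold-above : ∀ {j q r} → q ≤ r → columns j (threshold q) r ≡ suc j
columns-threshold-above {j} {q} {r} q≤r with suc r ≤? q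
... | yes r<q = ⊥-elim (<⇒≱ r<q q≤r)
... | no  _   = +-comm j 1

hits-threshold≡0 : ∀ {K b j} q → (∀ r → r < q → r < K → Misses b j r) →
  (∀ r → q ≤ r → r < K → Misses b (suc j) r) → hits b (columns j (threshold q)) K ≡ 0
hits-threshold≡0 {K} {b} {j} q below above = hits-≡0 K misses
  where
  misses : ∀ r → r < K → Misses b (columns j (threshold q) r) r
  misses r r<K with q ≤? r
  ... | yes q≤r = subst (λ x → Misses b x r) (sym (columns-threshold-above q≤r)) (above r q≤r r<K)
  ... | no  q≰r =
    subst (λ x → Misses b x r) (sym (columns-threshold-below (≰⇒> q≰r))) (below r (≰⇒> q≰r) r<K)

MinimalAt : (ℕ → ℕ) → ℕ → ℕ → (ℕ → ℕ) → Set
MinimalAt b K j t = ∀ t′ → Admissible (suc K) t′ → hits b (columns j t) K ≤ hits b (columns j t′) K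

minimal-if-no-hits : ∀ {b K j t} → hits b (columns j t) K ≡ 0 → MinimalAt b K j t
minimal-if-no-hits no-hits _ _ = subst (_≤ _) (sym no-hits) z≤n

minimal-constant : ∀ {K b j t x} → Ascending K b → (∀ r → r < K → columns j t r ≡ x) →
  (b 0 ≤ j × suc j < b K) ⊎ (x < b 0 ⊎ b K ≤ x) → MinimalAt b K j t
minimal-constant {K} {b} asc constant (inj₁ (b₀≤j , j+1<bK)) t′ adm =
  ≤-trans (subst (_≤ 1) (sym (hits-cong {b} K constant)) (hits-constant-≤1 K _ asc))
          (hits-admissible-≥1 asc b₀≤j j+1<bK adm)
minimal-constant {K} {b} {j} {t} asc constant (inj₂ outside) =
  minimal-if-no-hits {b} {K} {j} {t} (hits-≡0 K (λ r r<K →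
    subst (λ x → Misses b x r) (sym (constant r r<K)) (misses-outsideWindow asc outside r r<K)))

-- The window [b 0, b K) contains j + 1 but not j (Enters), or j but not j + 1 (Leaves).
Enters : (ℕ → ℕ) → ℕ → ℕ → Set
Enters b K j = b 0 ≡ suc j × suc j < b K

Leaves : (ℕ → ℕ) → ℕ → ℕ → Set
Leaves b K j = b 0 ≤ j × b K ≡ suc j

enters⇒¬leaves : ∀ {b K j} → Enters b K j → ¬ Leaves b K j
enters⇒¬leaves (_ , j+1<bK) (_ , bK≡j+1) = <-irrefl (sym bK≡j+1) j+1<bK

module _ {K b} (asc : Ascending K b) {j : ℕ} where

  minimal-at-0 : ¬ Enters b K j → MinimalAt b K j (threshold 0)
  minimal-at-0 ¬enters =
    minimal-constant {K} {b} {j} {threshold 0} asc (λ r _ → columns-threshold-above {j} {0} {r} z≤n) window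
    where
    window : (b 0 ≤ j × suc j < b K) ⊎ (suc j < b 0 ⊎ b K ≤ suc j)
    window with b 0 ≤? j | suc j <? b K
    ... | yes b₀≤j | yes j+1<bK = inj₁ (b₀≤j , j+1<bK)
    ... | _        | no  j+1≮bK = inj₂ (inj₂ (≮⇒≥ j+1≮bK))
    ... | no  b₀≰j | yes j+1<bK =
      inj₂ (inj₁ (≤∧≢⇒< (≰⇒> b₀≰j) (λ j+1≡b₀ → ¬enters (sym j+1≡b₀ , j+1<bK))))

  minimal-at-K : ¬ Leaves b K j → MinimalAt b K j (threshold K)
  minimal-at-K ¬leaves =
    minimal-constant {K} {b} {j} {threshold K} asc (λ r r<K → columns-threshold-below r<K) window
    where
    window : (b 0 ≤ j × suc j < b K) ⊎ (j < b 0 ⊎ b K ≤ j)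
    window with b 0 ≤? j | suc j <? b K
    ... | yes b₀≤j | yes j+1<bK = inj₁ (b₀≤j , j+1<bK)
    ... | no  b₀≰j | _          = inj₂ (inj₁ (≰⇒> b₀≰j))
    ... | yes b₀≤j | no  j+1≮bK =
      inj₂ (inj₂ (≤-pred (≤∧≢⇒< (≮⇒≥ j+1≮bK) (λ bK≡j+1 → ¬leaves (b₀≤j , bK≡j+1)))))

  minimal-after-entry : ∀ q → b 0 ≡ suc j → suc j < b q → MinimalAt b K j (threshold q)
  minimal-after-entry q b₀≡j+1 j+1<b_q =
    minimal-if-no-hits {b} {K} {j} {threshold q} (hits-threshold≡0 {K} {b} {j} q
    (λ r _ r<K → inj₁ (≤-trans (≤-reflexive (sym b₀≡j+1)) (ascending-mono asc z≤n (<⇒≤ r<K))))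
    (λ r q≤r r<K → inj₁ (<-≤-trans j+1<b_q (ascending-mono asc q≤r (<⇒≤ r<K)))))

  minimal-before-exit : ∀ q → q ≤ K → b q ≤ j → b K ≡ suc j → MinimalAt b K j (threshold q)
  minimal-before-exit q q≤K b_q≤j bK≡j+1 =
    minimal-if-no-hits {b} {K} {j} {threshold q} (hits-threshold≡0 {K} {b} {j} q
    (λ r r<q _ → inj₂ (≤-trans (ascending-mono asc r<q q≤K) b_q≤j))
    (λ r _ r<K → inj₂ (≤-trans (ascending-mono asc r<K ≤-refl) (≤-reflexive bK≡j+1))))

-- Row i of γ_S runs over the columns rowStart S (i - 1) ≤ c < rowStart S i.
rowStart : List ℕ → ℕ → ℕ
rowStart S r = at S r ∸ r

at-increasing : ∀ {S r} → Linked _<_ S → suc r < length S → at S r < at S (suc r)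
at-increasing [-]        (s≤s ())
at-increasing {r = zero}  (x<y ∷ _) _ = x<y
at-increasing {r = suc r} (_ ∷ S↑) (s≤s r+1<len) = at-increasing S↑ r+1<len

suc≤at : ∀ {S} → Linked _<_ S → 1 ≤ at S 0 → ∀ r → r < length S → suc r ≤ at S r
suc≤at S↑ 1≤s₀ zero    _       = 1≤s₀
suc≤at S↑ 1≤s₀ (suc r) r+1<len =
  ≤-trans (s≤s (suc≤at S↑ 1≤s₀ r (<-trans (n<1+n r) r+1<len))) (at-increasing S↑ r+1<len)

module _ {n K S} (kS : IsKSubset n (suc K) S) where
  open IsKSubset kS using (size; sorted; inRange)

  private
    <length : ∀ {r} → r ≤ K → r < length S
    <length r≤K = subst (_ <_) (sym size) (s≤s r≤K)

    suc≤s : ∀ {r} → r ≤ K → suc r ≤ at S r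
    suc≤s r≤K = suc≤at sorted (head≥1 size inRange) _ (<length r≤K)
      where
      head≥1 : ∀ {S′} → length S′ ≡ suc K → All (λ x → 1 ≤ x × x ≤ n) S′ → 1 ≤ at S′ 0
      head≥1 _ ((1≤x , _) ∷ _) = 1≤x

  rowStart-ascending : Ascending K (rowStart S)
  rowStart-ascending r r<K = ∸-monoˡ-≤ (suc r) (at-increasing sorted (<length r<K))

  rowStart-positive : ∀ {r} → r ≤ K → 1 ≤ rowStart S r
  rowStart-positive {r} r≤K = subst (_≤ rowStart S r) (m+n∸n≡m 1 r) (∸-monoˡ-≤ r (suc≤s r≤K))

  at≡rowStart+ : ∀ {r} → r ≤ K → at S r ≡ rowStart S r + r
  at≡rowStart+ {r} r≤K = sym (m∸n+n≡m (≤-trans (n≤1+n r) (suc≤s r≤K)))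

expVecℕ : ℕ → ℕ → (ℕ → ℕ) → ℕ → ℕ → ℕ
expVecℕ k j t i c = if ⌊ 1 ≤? i ⌋ ∧ ⌊ i ≤? k ∸ 1 ⌋ ∧ ⌊ c ≟ j + t i ⌋ then 1 else 0

γ-fromℕ : ∀ k S (g : ℕ → ℕ → ℕ) → γ k S (λ i c → fromℕ (g i c)) ≡
  fromℕ (sumBelow (λ r → sumBelow (λ t → g (suc r) (rowStart S r + t))
                                  (suc (rowStart S (suc r) ∸ 1) ∸ rowStart S r)) (k ∸ 1))
γ-fromℕ k S g =
  trans (sumRange-cong 1 (k ∸ 1) (λ i → sumRange-fromℕ (at S (i ∸ 1) ∸ (i ∸ 1)) (at S i ∸ i ∸ 1) (g i)))
        (sumRange-fromℕ 1 (k ∸ 1) rowTotal)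
  where
  rowTotal : ℕ → ℕ
  rowTotal i = sumBelow (λ t → g i (at S (i ∸ 1) ∸ (i ∸ 1) + t))
                        (suc (at S i ∸ i ∸ 1) ∸ (at S (i ∸ 1) ∸ (i ∸ 1)))

γ-expVec : ∀ {n K S} → IsKSubset n (suc K) S → ∀ j t →
  γ (suc K) S (expVec (suc K) j t) ≡ fromℕ (hits (rowStart S) (columns j t) K)
γ-expVec {n} {K} {S} kS j t = begin
  γ (suc K) S (expVec (suc K) j t)                      ≡⟨ Linear.cong-pointwise (γ-linear (suc K) S) expVec≡ ⟩
  γ (suc K) S (λ i c → fromℕ (expVecℕ (suc K) j t i c)) ≡⟨ γ-fromℕ (suc K) S (expVecℕ (suc K) j t) ⟩
  fromℕ (sumBelow rowTotal K)                           ≡⟨ cong fromℕ (sumBelow-cong K rowTotal≡) ⟩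
  fromℕ (hits (rowStart S) (columns j t) K)             ∎
  where
  open ≡-Reasoning
  expVec≡ : PointwiseEqual (expVec (suc K) j t) (λ i c → fromℕ (expVecℕ (suc K) j t i c))
  expVec≡ i c = fromℕ-if (⌊ 1 ≤? i ⌋ ∧ ⌊ i ≤? K ⌋ ∧ ⌊ c ≟ j + t i ⌋)

  rowTotal : ℕ → ℕ
  rowTotal r = sumBelow (λ c → expVecℕ (suc K) j t (suc r) (rowStart S r + c))
                        (suc (rowStart S (suc r) ∸ 1) ∸ rowStart S r)

  expVecℕ-row : ∀ {r} c → r < K → expVecℕ (suc K) j t (suc r) c ≡ δ c (j + t (suc r))
  expVecℕ-row {r} c r<K rewrite ⌊⌋-true (1 ≤? suc r) (s≤s z≤n) | ⌊⌋-true (suc r ≤? K) r<K = refl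

  rowTotal≡ : ∀ r → r < K → rowTotal r ≡ inInterval (rowStart S r) (rowStart S (suc r)) (columns j t r)
  rowTotal≡ r r<K =
    trans (sumBelow-cong (suc (rowStart S (suc r) ∸ 1) ∸ rowStart S r)
                         (λ c _ → expVecℕ-row (rowStart S r + c) r<K))
          (rowCount (rowStart S r) (rowStart S (suc r)) (columns j t r) (rowStart-positive kS r<K))

vertex-minimal : ∀ {n K S j t} → IsKSubset n (suc K) S → MinimalAt (rowStart S) K j t →
  ∀ α → Newt (suc K) j α → γ (suc K) S (expVec (suc K) j t) ℚ.≤ γ (suc K) S α
vertex-minimal {K = K} {S} {j} {t} kS minimal = γ-minimal-on-Newt (suc K) j S t (λ t′ adm →
  subst₂ ℚ._≤_ (sym (γ-expVec kS j t)) (sym (γ-expVec kS j t′)) (fromℕ-mono-≤ (minimal t′ adm)))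

at∈take : ∀ {m ν} S → m ≤ ν → m < length S → at S m ∈ take (suc ν) S
at∈take {zero}          (x ∷ xs) _         _          = here refl
at∈take {suc m} {suc ν} (x ∷ xs) (s≤s m≤ν) (s≤s m<len) = there (at∈take xs m≤ν m<len)

∈take⇒at : ∀ {x ν} S → x ∈ take (suc ν) S → Σ ℕ λ m → m ≤ ν × at S m ≡ x
∈take⇒at             (y ∷ ys) (here x≡y)  = 0 , z≤n , sym x≡y
∈take⇒at {ν = suc ν} (y ∷ ys) (there x∈) =
  let (m , m≤ν , at≡x) = ∈take⇒at ys x∈ in suc m , s≤s m≤ν , at≡x

∉take-[] : ∀ {x : ℕ} k → x ∉ take k []
∉take-[] zero    ()
∉take-[] (suc k) ()

-- slice S (1 + μ) (1 + ν) holds the entries of S at the 0-based positions μ, …, ν.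
at∈slice : ∀ {μ m ν} S → μ ≤ m → m ≤ ν → m < length S → at S m ∈ slice S (suc μ) (suc ν)
at∈slice {zero} S _ m≤ν m<len = at∈take S m≤ν m<len
at∈slice {suc μ} {suc m} {suc ν} (x ∷ xs) (s≤s μ≤m) (s≤s m≤ν) (s≤s m<len) =
  at∈slice xs μ≤m m≤ν m<len

∈slice⇒at : ∀ {x μ ν} S → x ∈ slice S (suc μ) (suc ν) → Σ ℕ λ m → μ ≤ m × m ≤ ν × at S m ≡ x
∈slice⇒at {μ = zero}          S        x∈ =
  let (m , m≤ν , at≡x) = ∈take⇒at S x∈ in m , z≤n , m≤ν , at≡x
∈slice⇒at {μ = suc μ} {suc ν} (y ∷ ys) x∈ =
  let (m , μ≤m , m≤ν , at≡x) = ∈slice⇒at ys x∈ in suc m , s≤s μ≤m , s≤s m≤ν , at≡x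
∈slice⇒at {μ = suc μ} {suc ν} []       x∈ = ⊥-elim (∉take-[] (suc ν ∸ μ) x∈)
∈slice⇒at {μ = suc zero}    {zero} S ()
∈slice⇒at {μ = suc (suc μ)} {zero} S ()

slice-sameSet : ∀ {μ ν} X Y → (∀ {m} → μ ≤ m → m ≤ ν → at X m ≡ at Y m) →
  ν < length X → ν < length Y →
  SameSet (slice X (suc μ) (suc ν)) (slice Y (suc μ) (suc ν))
slice-sameSet {μ} {ν} X Y X≡Y ν<lenX ν<lenY x =
  mk⇔ (transfer X Y X≡Y ν<lenY) (transfer Y X (λ μ≤m m≤ν → sym (X≡Y μ≤m m≤ν)) ν<lenX)
  where
  transfer : ∀ A B → (∀ {m} → μ ≤ m → m ≤ ν → at A m ≡ at B m) → ν < length B →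
    x ∈ slice A (suc μ) (suc ν) → x ∈ slice B (suc μ) (suc ν)
  transfer A B A≡B ν<lenB x∈ with ∈slice⇒at A x∈
  ... | m , μ≤m , m≤ν , at≡x =
    subst (_∈ _) (trans (sym (A≡B μ≤m m≤ν)) at≡x) (at∈slice B μ≤m m≤ν (≤-<-trans m≤ν ν<lenB))

cyclicOrder-rotate : ∀ {a b c d} → CyclicOrder a b c d → CyclicOrder b c d a
cyclicOrder-rotate (inj₁ abcd)               = inj₂ (inj₂ (inj₂ abcd))
cyclicOrder-rotate (inj₂ (inj₁ bcda))        = inj₁ bcda
cyclicOrder-rotate (inj₂ (inj₂ (inj₁ cdab))) = inj₂ (inj₁ cdab)
cyclicOrder-rotate (inj₂ (inj₂ (inj₂ dabc))) = inj₂ (inj₂ (inj₁ dabc))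

weaklySeparated-sym : ∀ {A B} → WeaklySeparated A B → WeaklySeparated B A
weaklySeparated-sym separated (a , b , c , d , abcd , a∈B∖A , c∈B∖A , b∈A∖B , d∈A∖B) =
  separated (b , c , d , a , cyclicOrder-rotate abcd , b∈A∖B , d∈A∖B , c∈B∖A , a∈B∖A)

noncrossing-sym : ∀ {k A B} → Noncrossing k A B → Noncrossing k B A
noncrossing-sym noncrossing p q 1≤p p<q q≤k with noncrossing p q 1≤p p<q q≤k
... | inj₁ separated = inj₁ (weaklySeparated-sym separated)
... | inj₂ ¬same     = inj₂ (λ same → ¬same (λ x → mk⇔ (Equivalence.from (same x)) (Equivalence.to (same x))))

record CrossingPattern (j μ ρ : ℕ) (X Y : List ℕ) : Set where
  field
    μ≤ρ    : μ ≤ ρ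
    X-flat : ∀ {m} → m ≤ ρ → rowStart X m ≡ suc j
    X-jump : suc j < rowStart X (suc ρ)
    Y-low  : rowStart Y μ ≤ j
    Y-flat : ∀ {m} → suc μ ≤ m → m ≤ suc ρ → rowStart Y m ≡ suc j

module _ {n K j μ ρ X Y} (kX : IsKSubset n (suc K) X) (kY : IsKSubset n (suc K) Y) (ρ<K : ρ < K)
         (crossing : CrossingPattern j μ ρ X Y) where
  open CrossingPattern crossing

  private
    ≤ρ⊎≡ρ+1 : ∀ {m} → m ≤ suc ρ → m ≤ ρ ⊎ m ≡ suc ρ
    ≤ρ⊎≡ρ+1 m≤ρ+1 with m≤n⇒m<n∨m≡n m≤ρ+1
    ... | inj₁ (s≤s m≤ρ) = inj₁ m≤ρ
    ... | inj₂ m≡ρ+1     = inj₂ m≡ρ+1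

    at∈outer : ∀ S → length S ≡ suc K → ∀ {m} → μ ≤ m → m ≤ suc ρ →
      at S m ∈ slice S (suc μ) (suc (suc ρ))
    at∈outer S size μ≤m m≤ρ+1 =
      at∈slice S μ≤m m≤ρ+1 (subst (_ <_) (sym size) (s≤s (≤-trans m≤ρ+1 ρ<K)))

    X-at : ∀ {m} → m ≤ ρ → at X m ≡ suc j + m
    X-at {m} m≤ρ = trans (at≡rowStart+ kX (≤-trans m≤ρ (<⇒≤ ρ<K))) (cong (_+ m) (X-flat m≤ρ))

    X-at-jump : suc j + suc ρ < at X (suc ρ)
    X-at-jump = subst (suc j + suc ρ <_) (sym (at≡rowStart+ kX ρ<K)) (+-monoˡ-< (suc ρ) X-jump)

    Y-at-low : at Y μ < suc j + μ
    Y-at-low =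
      subst (_< suc j + μ) (sym (at≡rowStart+ kY (≤-trans μ≤ρ (<⇒≤ ρ<K)))) (+-monoˡ-< μ (s≤s Y-low))

    Y-at : ∀ {m} → suc μ ≤ m → m ≤ suc ρ → at Y m ≡ suc j + m
    Y-at {m} μ<m m≤ρ+1 = trans (at≡rowStart+ kY (≤-trans m≤ρ+1 ρ<K)) (cong (_+ m) (Y-flat μ<m m≤ρ+1))

    X-above : ∀ {m} → μ ≤ m → m ≤ suc ρ → suc j + μ ≤ at X m
    X-above μ≤m m≤ρ+1 with ≤ρ⊎≡ρ+1 m≤ρ+1
    ... | inj₁ m≤ρ = subst (suc j + μ ≤_) (sym (X-at m≤ρ)) (+-monoʳ-≤ (suc j) μ≤m)
    ... | inj₂ refl = <⇒≤ (<-trans (+-monoʳ-< (suc j) (s≤s μ≤ρ)) X-at-jump)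

    X-avoids : ∀ {m} → m ≤ suc ρ → at X m ≢ suc j + suc ρ
    X-avoids m≤ρ+1 Xₘ≡ with ≤ρ⊎≡ρ+1 m≤ρ+1
    ... | inj₁ m≤ρ = <-irrefl (+-cancelˡ-≡ (suc j) _ _ (trans (sym (X-at m≤ρ)) Xₘ≡)) (s≤s m≤ρ)
    ... | inj₂ refl = <-irrefl (sym Xₘ≡) X-at-jump

    Y-below : ∀ {m} → μ ≤ m → m ≤ suc ρ → at Y m ≤ suc j + suc ρ
    Y-below μ≤m m≤ρ+1 with m≤n⇒m<n∨m≡n μ≤m
    ... | inj₁ μ<m = ≤-trans (≤-reflexive (Y-at μ<m m≤ρ+1)) (+-monoʳ-≤ (suc j) m≤ρ+1)
    ... | inj₂ refl = <⇒≤ (<-≤-trans Y-at-low (+-monoʳ-≤ (suc j) m≤ρ+1))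

    Y-avoids : ∀ {m} → μ ≤ m → m ≤ suc ρ → at Y m ≢ suc j + μ
    Y-avoids μ≤m m≤ρ+1 Yₘ≡ with m≤n⇒m<n∨m≡n μ≤m
    ... | inj₁ μ<m = <-irrefl (sym (+-cancelˡ-≡ (suc j) _ _ (trans (sym (Y-at μ<m m≤ρ+1)) Yₘ≡))) μ<m
    ... | inj₂ refl = <-irrefl Yₘ≡ Y-at-low

  -- On the positions μ, …, ρ + 1 the entries of X are j+1+μ, …, j+1+ρ followed by one above j+ρ+2,
  -- and those of Y are one below j+1+μ followed by j+2+μ, …, j+ρ+2. So the inner slices agree,
  -- while Y_μ < X_μ < Y_{ρ+1} < X_{ρ+1} shows that the outer slices are not weakly separated.
  crossingPattern⇒¬noncrossing : ¬ Noncrossing (suc K) X Y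
  crossingPattern⇒¬noncrossing noncrossing
    with noncrossing (suc μ) (suc (suc ρ)) (s≤s z≤n) (s≤s (s≤s μ≤ρ)) (s≤s ρ<K)
  ... | inj₁ separated = separated
    (at X μ , at Y (suc ρ) , at X (suc ρ) , at Y μ ,
     inj₂ (inj₂ (inj₂ (Yμ<Xμ , Xμ<Yρ+1 , Yρ+1<Xρ+1))) ,
     (at∈outer X sizeX ≤-refl μ≤ρ+1 , Xμ∉Y) , (at∈outer X sizeX μ≤ρ+1 ≤-refl , Xρ+1∉Y) ,
     (at∈outer Y sizeY μ≤ρ+1 ≤-refl , Yρ+1∉X) , (at∈outer Y sizeY ≤-refl μ≤ρ+1 , Yμ∉X))
    where
    sizeX = IsKSubset.size kX
    sizeY = IsKSubset.size kY
    μ≤ρ+1 = m≤n⇒m≤1+n μ≤ρ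
    Xμ≡ = X-at μ≤ρ
    Yρ+1≡ = Y-at (s≤s μ≤ρ) ≤-refl

    Yμ<Xμ : at Y μ < at X μ
    Yμ<Xμ = subst (at Y μ <_) (sym Xμ≡) Y-at-low
    Xμ<Yρ+1 : at X μ < at Y (suc ρ)
    Xμ<Yρ+1 = subst₂ _<_ (sym Xμ≡) (sym Yρ+1≡) (+-monoʳ-< (suc j) (s≤s μ≤ρ))
    Yρ+1<Xρ+1 : at Y (suc ρ) < at X (suc ρ)
    Yρ+1<Xρ+1 = subst (_< at X (suc ρ)) (sym Yρ+1≡) X-at-jump

    Xμ∉Y : at X μ ∉ slice Y (suc μ) (suc (suc ρ))
    Xμ∉Y x∈ with ∈slice⇒at {μ = μ} Y x∈
    ... | m , μ≤m , m≤ρ+1 , Yₘ≡ = Y-avoids μ≤m m≤ρ+1 (trans Yₘ≡ Xμ≡)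
    Xρ+1∉Y : at X (suc ρ) ∉ slice Y (suc μ) (suc (suc ρ))
    Xρ+1∉Y x∈ with ∈slice⇒at {μ = μ} Y x∈
    ... | m , μ≤m , m≤ρ+1 , Yₘ≡ = <⇒≱ X-at-jump (subst (_≤ _) Yₘ≡ (Y-below μ≤m m≤ρ+1))
    Yρ+1∉X : at Y (suc ρ) ∉ slice X (suc μ) (suc (suc ρ))
    Yρ+1∉X x∈ with ∈slice⇒at {μ = μ} X x∈
    ... | m , μ≤m , m≤ρ+1 , Xₘ≡ = X-avoids m≤ρ+1 (trans Xₘ≡ Yρ+1≡)
    Yμ∉X : at Y μ ∉ slice X (suc μ) (suc (suc ρ))
    Yμ∉X x∈ with ∈slice⇒at {μ = μ} X x∈
    ... | m , μ≤m , m≤ρ+1 , Xₘ≡ = <⇒≱ Y-at-low (subst (_ ≤_) Xₘ≡ (X-above μ≤m m≤ρ+1))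
  ... | inj₂ ¬same = ¬same (slice-sameSet {suc μ} {ρ} X Y X≡Y (ρ<length kX) (ρ<length kY))
    where
    ρ<length : ∀ {S} → IsKSubset n (suc K) S → ρ < length S
    ρ<length kS = subst (ρ <_) (sym (IsKSubset.size kS)) (s≤s (<⇒≤ ρ<K))
    X≡Y : ∀ {m} → suc μ ≤ m → m ≤ ρ → at X m ≡ at Y m
    X≡Y μ<m m≤ρ = trans (X-at m≤ρ) (sym (Y-at μ<m (m≤n⇒m≤1+n m≤ρ)))

enters? : ∀ b K j → Dec (Enters b K j)
enters? b K j = (b 0 ≟ suc j) ×-dec (suc j <? b K)

leaves? : ∀ b K j → Dec (Leaves b K j)
leaves? b K j = (b 0 ≤? j) ×-dec (b K ≟ suc j)

CommonThreshold : ℕ → ℕ → List ℕ → List ℕ → Set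
CommonThreshold K j I J =
  Σ ℕ λ q → MinimalAt (rowStart I) K j (threshold q) × MinimalAt (rowStart J) K j (threshold q)

module _ {n K} {j : ℕ} {X Y} (kX : IsKSubset n (suc K) X) (kY : IsKSubset n (suc K) Y) where
  private
    ascX = rowStart-ascending kX
    ascY = rowStart-ascending kY

  -- Let row ρ of X contain j + 1. Either Y has left j behind by row ρ + 1, and then the
  -- threshold ρ + 1 hits no row of either subset, or the rows of X and Y form a crossing pattern.
  enterLeave-commonThreshold : Enters (rowStart X) K j → Leaves (rowStart Y) K j →
    Noncrossing (suc K) X Y → CommonThreshold K j X Y
  enterLeave-commonThreshold (bX₀≡j+1 , j+1<bXK) (bY₀≤j , bYK≡j+1) noncrossing
    with rowContaining (rowStart X) (suc j) K (≤-reflexive bX₀≡j+1) j+1<bXK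
  ... | ρ , ρ<K , bXρ≤j+1 , j+1<bXρ+1 with rowStart Y (suc ρ) ≤? j
  ...   | yes bYρ+1≤j = suc ρ , minimal-after-entry ascX (suc ρ) bX₀≡j+1 j+1<bXρ+1
                              , minimal-before-exit ascY (suc ρ) ρ<K bYρ+1≤j bYK≡j+1
  ...   | no  bYρ+1≰j with rowContaining (rowStart Y) j (suc ρ) bY₀≤j (≰⇒> bYρ+1≰j)
  ...     | μ , μ<ρ+1 , bYμ≤j , j<bYμ+1 =
    ⊥-elim (crossingPattern⇒¬noncrossing kX kY ρ<K crossing noncrossing)
    where
    crossing : CrossingPattern j μ ρ X Y
    crossing = record
      { μ≤ρ    = ≤-pred μ<ρ+1
      ; X-flat = λ {m} m≤ρ → ≤-antisym
          (≤-trans (ascending-mono ascX m≤ρ (<⇒≤ ρ<K)) bXρ≤j+1)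
          (subst (_≤ rowStart X m) bX₀≡j+1 (ascending-mono ascX z≤n (≤-trans m≤ρ (<⇒≤ ρ<K))))
      ; X-jump = j+1<bXρ+1
      ; Y-low  = bYμ≤j
      ; Y-flat = λ {m} μ<m m≤ρ+1 → ≤-antisym
          (subst (rowStart Y m ≤_) bYK≡j+1 (ascending-mono ascY (≤-trans m≤ρ+1 ρ<K) ≤-refl))
          (≤-trans j<bYμ+1 (ascending-mono ascY μ<m (≤-trans m≤ρ+1 ρ<K)))
      }

  entering-commonThreshold : Enters (rowStart X) K j → Noncrossing (suc K) X Y → CommonThreshold K j X Y
  entering-commonThreshold entersX noncrossing with leaves? (rowStart Y) K j
  ... | yes leavesY = enterLeave-commonThreshold entersX leavesY noncrossing
  ... | no ¬leavesY = K , minimal-at-K ascX (enters⇒¬leaves {rowStart X} {K} {j} entersX)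
                        , minimal-at-K ascY ¬leavesY

commonThreshold : ∀ {n K j I J} → IsKSubset n (suc K) I → IsKSubset n (suc K) J →
  Noncrossing (suc K) I J → CommonThreshold K j I J
commonThreshold {K = K} {j} {I} {J} kI kJ noncrossing
  with enters? (rowStart I) K j | enters? (rowStart J) K j
... | no ¬entersI | no ¬entersJ =
  0 , minimal-at-0 (rowStart-ascending kI) ¬entersI , minimal-at-0 (rowStart-ascending kJ) ¬entersJ
... | yes entersI | _ = entering-commonThreshold kI kJ entersI noncrossing
... | no _ | yes entersJ =
  let q , minimalJ , minimalI = entering-commonThreshold kJ kI entersJ (noncrossing-sym noncrossing)
  in q , minimalI , minimalJ

mainTheorem11 : (k n : ℕ) → 2 ≤ k → k + 2 ≤ n →
    (I J : List ℕ) → IsKSubset n k I → IsKSubset n k J →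
    ¬ Frozen n k I → ¬ Frozen n k J → Noncrossing k I J →
    (j : ℕ) → 1 ≤ j → j ≤ n ∸ k ∸ 1 →
    Σ Point λ α₀ → Newt k j α₀ ×
      ((α : Point) → Newt k j α →
        γ k I α₀ ℚ.≤ γ k I α × γ k J α₀ ℚ.≤ γ k J α)
mainTheorem11 (suc K) n _ _ I J kI kJ _ _ noncrossing j _ _ with commonThreshold {j = j} kI kJ noncrossing
... | q , minimalI , minimalJ =
  expVec (suc K) j (threshold q) , expVec∈Newt (suc K) j (threshold q) (threshold-admissible (suc K) q) ,
  λ α α∈Newt → vertex-minimal {t = threshold q} kI minimalI α α∈Newt ,
               vertex-minimal {t = threshold q} kJ minimalJ α α∈Newt
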